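{- Let $r\ge1$, $R=\{\bm c^\ast_1,\dots,\bm c^\ast_r\}$, let $B\ne R$ be a basis and let $P=\pi(B)$, written as $P=(B\setminus\{\bm y\})\cup\{\bm c^\ast_i\}$ with $\bm y=\min(B\setminus R)$ and $\bm c^\ast_i=\min(R\cap\mathrm{Ex}_{\mathrm{in}}(B;\bm y))$. Let $\bm\upsilon\in\mathrm{Ex}_{\mathrm{in}}(P;\bm c^\ast_i)$ and $\bm z=\textsc{Succ}(\bm\upsilon)$. If $(P\setminus\{\bm c^\ast_i\})\cup\{\bm z\}$ is not a basis, then: (i) $z_j=0$ for all $j\in[i+1,r]$; and (ii) for every $\bm z'\in GF(2)^r$ with $z'_p=z_p$ for all $p\in[1,i]$, the set $(P\setminus\{\bm c^\ast_i\})\cup\{\bm z'\}$ is not a basis.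
   Context: Work over $GF(2)$. $\bm c^\ast_i\in GF(2)^r$ has $i$-th entry 1 and others 0; $\bm 0$ and $\bm 1$ are the all-zero and all-one vectors. A basis is a set of $r$ linearly independent vectors in $GF(2)^r$. For $\bm c=(c_1,\dots,c_r)$, $\mathrm{bin}(\bm c)$ is the integer with binary digits $c_1c_2\dots c_r$ ($c_1$ most significant), $\bm c\prec\bm d$ iff $\mathrm{bin}(\bm c)<\mathrm{bin}(\bm d)$, and $\min$ is with respect to $\prec$. $\textsc{Succ}(\bm c)$ is the vector with $\mathrm{bin}(\textsc{Succ}(\bm c))=\mathrm{bin}(\bm c)+1$ if $\bm c\notin\{\bm 0,\bm 1\}$, and $\textsc{Succ}(\bm c)=\bm 0$ if $\bm c\in\{\bm 0,\bm 1\}$. For a basis $B$ and $\bm x\in B$, $\mathrm{Ex}_{\mathrm{in}}(B;\bm x)=\{\bm y\notin B:(B\setminus\{\bm x\})\cup\{\bm y\}\text{ is a basis}\}\cup\{\bm x\}$. For a basis $B\ne R$ with $\bm y'=\min(B\setminus R)$, $\pi(B)=(B\setminus\{\bm y'\})\cup\{\min(R\cap\mathrm{Ex}_{\mathrm{in}}(B;\bm y'))\}$. -}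

module Defs where

open import Data.Bool using (Bool; true; false; _∧_; _∨_; not; _xor_; if_then_else_)
open import Data.Nat using (ℕ; zero; suc; _+_; _*_; _^_; _≤_; _<_)
open import Data.Fin using (Fin; toℕ)
import Data.Fin as F
open import Data.Vec using (Vec; []; _∷_; replicate; lookup; zipWith)
open import Data.List using (List; []; _∷_; _++_; map; length; filterᵇ; foldr)
open import Data.Product using (_×_; _,_; proj₂; ∃-syntax)
open import Data.Sum using (_⊎_)
open import Relation.Binary.PropositionalEquality using (_≡_)
open import Relation.Nullary using (¬_)

GF2^ : ℕ → Set
GF2^ r = Vec Bool r

𝟎 : ∀ {r} → GF2^ r
𝟎 = replicate _ false

𝟏 : ∀ {r} → GF2^ r
𝟏 = replicate _ true

_⊕_ : ∀ {r} → GF2^ r → GF2^ r → GF2^ r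
_⊕_ = zipWith _xor_

-- unit vector c*_i (index i : Fin r corresponds to paper index toℕ i + 1)
c* : ∀ {r} → Fin r → GF2^ r
c* F.zero    = true ∷ 𝟎
c* (F.suc i) = false ∷ c* i

_==_ : ∀ {r} → GF2^ r → GF2^ r → Bool
[] == [] = true
(a ∷ u) == (b ∷ v) = (if a then b else not b) ∧ (u == v)

allVecs : (r : ℕ) → List (GF2^ r)
allVecs zero = [] ∷ []
allVecs (suc r) = map (false ∷_) (allVecs r) ++ map (true ∷_) (allVecs r)

-- bin(c): c_1 is the most significant digit
b2n : Bool → ℕ
b2n true = 1
b2n false = 0

bin : ∀ {r} → GF2^ r → ℕ
bin [] = 0
bin {suc n} (b ∷ v) = b2n b * 2 ^ n + bin v

_≺_ : ∀ {r} → GF2^ r → GF2^ r → Set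
c ≺ d = bin c < bin d

-- binary increment (MSB first); returns (carry-out, result)
inc' : ∀ {n} → GF2^ n → Bool × GF2^ n
inc' [] = true , []
inc' (b ∷ v) with inc' v
... | c , v' = (b ∧ c) , ((b xor c) ∷ v')

Succ : ∀ {r} → GF2^ r → GF2^ r
Succ c = if (c == 𝟎) ∨ (c == 𝟏) then 𝟎 else proj₂ (inc' c)

VSet : ℕ → Set
VSet r = GF2^ r → Bool

swap : ∀ {r} → VSet r → GF2^ r → GF2^ r → VSet r
swap S x y v = (S v ∧ not (v == x)) ∨ (v == y)

card : ∀ {r} → VSet r → ℕ
card {r} S = length (filterᵇ S (allVecs r))

sumSet : ∀ {r} → VSet r → GF2^ r
sumSet {r} a = foldr (λ v acc → if a v then v ⊕ acc else acc) 𝟎 (allVecs r)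

LinIndep : ∀ {r} → VSet r → Set
LinIndep {r} S = ∀ (a : VSet r) → (∀ v → a v ≡ true → S v ≡ true) →
  sumSet a ≡ 𝟎 → ∀ v → a v ≡ false

IsBasis : ∀ {r} → VSet r → Set
IsBasis {r} S = card S ≡ r × LinIndep S

InR : ∀ {r} → GF2^ r → Set
InR v = ∃[ j ] v ≡ c* j

Exin : ∀ {r} → VSet r → GF2^ r → GF2^ r → Set
Exin B x y = (B y ≡ false × IsBasis (swap B x y)) ⊎ y ≡ x

IsMin : ∀ {r} → (GF2^ r → Set) → GF2^ r → Set
IsMin P x = P x × (∀ y → P y → ¬ (y ≺ x))

EqR : ∀ {r} → VSet r → Set
EqR B = ∀ v → (B v ≡ true → InR v) × (InR v → B v ≡ true)

{-# OPTIONS --safe #-}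
module Submission where

-- Put Q = B ─ y. Exchanging y for v keeps a basis exactly when v ∉ span Q, so Ex_in(B; y) is the
-- complement of span Q; and as c*_i ∉ B, Q is also P ─ c*_i. Each c*_j with j > i precedes c*_i,
-- so the minimality of c*_i puts it in span Q; hence span Q contains every vector vanishing on the
-- first i coordinates. The exchange with z = Succ υ fails, so z ∈ span Q, while υ ∉ span Q.
-- (ii) z' + z vanishes on the first i coordinates, so z' ∈ span Q as well.
-- (i) Incrementing leaves the coordinates before any one of Succ υ unchanged, so a one at j > i
-- would make υ + z vanish on the first i coordinates and put υ in span Q.
-- Span membership is only obtained under double negation, which suffices because conclusion (ii)
-- is negative and conclusion (i) is decidable.

open import Defs
open import Data.Bool using (Bool; true; false)
open import Data.Nat using (ℕ; _≤_; _<_)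
open import Data.Fin using (Fin; toℕ)
open import Data.Vec using (lookup)
open import Data.Product using (_×_)
open import Relation.Binary.PropositionalEquality using (_≡_)
open import Relation.Nullary using (¬_)

open import Algebra.Bundles using (CommutativeMonoid)
import Algebra.Properties.CommutativeSemigroup as CommutativeSemigroupProperties
open import Data.Bool using (_∧_; _∨_; not; _xor_; if_then_else_; T)
open import Data.Bool.Properties
  using (xor-assoc; xor-comm; xor-identityˡ; xor-identityʳ; xor-same;
         ∧-identityʳ; ∧-zeroʳ; ∨-identityʳ; ∨-zeroʳ)
open import Data.Empty using (⊥-elim)
open import Data.Fin using (zero; suc)
open import Data.List using (List; []; _∷_; _++_; map; length; filterᵇ; foldr)
open import Data.List.Properties using (filter-++; filter-≐; filter-none)
import Data.List.Relation.Unary.All as All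
open import Data.Nat using (zero; suc; _+_; _*_; _^_; z≤n; s≤s)
open import Data.Nat.Properties
  using (+-suc; +-comm; m+1+n≢m; ≰⇒>; <-≤-trans; ≤-trans; ≤-reflexive;
         m≤m+n; +-monoʳ-<; ≤-<-trans; *-identityˡ; module ≤-Reasoning)
open import Data.Product using (Σ-syntax; _,_; proj₁; proj₂)
open import Data.Sum using (inj₁; inj₂; [_,_]′)
open import Data.Vec using ([]; _∷_)
open import Data.Vec.Properties using (lookup-zipWith; lookup-replicate; ∷-injectiveʳ)
open import Data.Vec.Relation.Binary.Pointwise.Inductive
  using (Pointwise-≡⇒≡; zipWith-assoc; zipWith-comm; zipWith-identityˡ; zipWith-identityʳ)
open import Function using (id; _∘_)
open import Level using (0ℓ)
open import Relation.Binary.PropositionalEquality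
  using (refl; sym; trans; cong; cong₂; subst; _≗_; module ≡-Reasoning)
open import Relation.Binary.PropositionalEquality.Algebra using (isMagma)
open import Relation.Nullary using (contradiction)
open import Relation.Nullary.Decidable using (T?)
open import Relation.Nullary.Reflects using (Reflects; ofʸ; ofⁿ; invert; det)

private variable
  n : ℕ

⊕-assoc : (u v w : GF2^ n) → (u ⊕ v) ⊕ w ≡ u ⊕ (v ⊕ w)
⊕-assoc u v w = Pointwise-≡⇒≡ (zipWith-assoc xor-assoc u v w)

⊕-comm : (u v : GF2^ n) → u ⊕ v ≡ v ⊕ u
⊕-comm u v = Pointwise-≡⇒≡ (zipWith-comm xor-comm u v)

⊕-identityˡ : (v : GF2^ n) → 𝟎 ⊕ v ≡ v
⊕-identityˡ v = Pointwise-≡⇒≡ (zipWith-identityˡ xor-identityˡ v)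

⊕-identityʳ : (v : GF2^ n) → v ⊕ 𝟎 ≡ v
⊕-identityʳ v = Pointwise-≡⇒≡ (zipWith-identityʳ xor-identityʳ v)

⊕-self : (v : GF2^ n) → v ⊕ v ≡ 𝟎
⊕-self []      = refl
⊕-self (b ∷ v) = cong₂ _∷_ (xor-same b) (⊕-self v)

x⊕y⊕y≡x : (u v : GF2^ n) → (u ⊕ v) ⊕ v ≡ u
x⊕y⊕y≡x u v = trans (⊕-assoc u v v) (trans (cong (u ⊕_) (⊕-self v)) (⊕-identityʳ u))

⊕-commutativeMonoid : ℕ → CommutativeMonoid 0ℓ 0ℓ
⊕-commutativeMonoid n = record
  { isCommutativeMonoid = record
    { isMonoid = record
      { isSemigroup = record { isMagma = isMagma (_⊕_ {n}) ; assoc = ⊕-assoc }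
      ; identity    = ⊕-identityˡ , ⊕-identityʳ
      }
    ; comm = ⊕-comm
    }
  }

⊕-interchange : (u v w x : GF2^ n) → (u ⊕ v) ⊕ (w ⊕ x) ≡ (u ⊕ w) ⊕ (v ⊕ x)
⊕-interchange {n} = CommutativeSemigroupProperties.interchange
  (CommutativeMonoid.commutativeSemigroup (⊕-commutativeMonoid n))

∷-reflects : {x b : Bool} {u v : GF2^ n} → Reflects (u ≡ v) b → Reflects (x ∷ u ≡ x ∷ v) b
∷-reflects (ofʸ refl) = ofʸ refl
∷-reflects (ofⁿ u≢v)  = ofⁿ (u≢v ∘ ∷-injectiveʳ)

==-reflects : (u v : GF2^ n) → Reflects (u ≡ v) (u == v)
==-reflects []          []          = ofʸ refl
==-reflects (true  ∷ u) (true  ∷ v) = ∷-reflects (==-reflects u v)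
==-reflects (false ∷ u) (false ∷ v) = ∷-reflects (==-reflects u v)
==-reflects (true  ∷ u) (false ∷ v) = ofⁿ λ ()
==-reflects (false ∷ u) (true  ∷ v) = ofⁿ λ ()

==-refl : (v : GF2^ n) → (v == v) ≡ true
==-refl v = det (==-reflects v v) (ofʸ refl)

==-sound : {u v : GF2^ n} → (u == v) ≡ true → u ≡ v
==-sound {u = u} {v} eq = invert (subst (Reflects (u ≡ v)) eq (==-reflects u v))

infixl 6 _∪_ _─_ _∆_
infix  4 _⊆_

_∪_ : VSet n → VSet n → VSet n
(S ∪ S′) v = S v ∨ S′ v

_─_ : VSet n → GF2^ n → VSet n
(S ─ x) v = S v ∧ not (v == x)

⁅_⁆ : GF2^ n → VSet n
⁅ x ⁆ v = v == x

∅ : VSet n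
∅ _ = false

_∆_ : VSet n → VSet n → VSet n
(a ∆ b) v = a v xor b v

_⊆_ : VSet n → VSet n → Set
S ⊆ S′ = ∀ v → S v ≡ true → S′ v ≡ true

⊆-trans : {S₁ S₂ S₃ : VSet n} → S₁ ⊆ S₂ → S₂ ⊆ S₃ → S₁ ⊆ S₃
⊆-trans S₁⊆S₂ S₂⊆S₃ v = S₂⊆S₃ v ∘ S₁⊆S₂ v

≗⇒⊆ : {S S′ : VSet n} → S ≗ S′ → S ⊆ S′
≗⇒⊆ S≗S′ v = trans (sym (S≗S′ v))

⊆-∪ˡ : (S S′ : VSet n) → S ⊆ S ∪ S′
⊆-∪ˡ S S′ v = cong (_∨ S′ v)

⊆-∪ʳ : (S S′ : VSet n) → S′ ⊆ S ∪ S′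
⊆-∪ʳ S S′ v S′v = trans (cong (S v ∨_) S′v) (∨-zeroʳ (S v))

─-⊆ : (S : VSet n) (x : GF2^ n) → S ─ x ⊆ S
─-⊆ S x v with S v
... | true  = λ _ → refl
... | false = id

∆-⊆ : {a b S : VSet n} → a ⊆ S → b ⊆ S → a ∆ b ⊆ S
∆-⊆ {a = a} a⊆S b⊆S v with a v in av
... | true  = λ _ → a⊆S v av
... | false = b⊆S v

⁅⁆-⊆ : {S : VSet n} {v : GF2^ n} → S v ≡ true → ⁅ v ⁆ ⊆ S
⁅⁆-⊆ {S = S} v∈S w w==v = subst (λ u → S u ≡ true) (sym (==-sound w==v)) v∈S

∌-⊆ : {a S : VSet n} {v : GF2^ n} → a ⊆ S → S v ≡ false → a v ≡ false
∌-⊆ {a = a} {v = v} a⊆S v∉S with a v in av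
... | true  = contradiction (trans (sym (a⊆S v av)) v∉S) λ ()
... | false = refl

⊆-∪⁅⁆ : {a S : VSet n} {v : GF2^ n} → a ⊆ S ∪ ⁅ v ⁆ → a v ≡ false → a ⊆ S
⊆-∪⁅⁆ {S = S} {v} a⊆ av w aw with w == v | ==-reflects w v | a⊆ w aw
... | true  | ofʸ refl | _   = contradiction (trans (sym aw) av) λ ()
... | false | _        | S∪ = trans (sym (∨-identityʳ (S w))) S∪

─∪⁅⁆ : {S : VSet n} {x : GF2^ n} → S x ≡ true → S ─ x ∪ ⁅ x ⁆ ≗ S
─∪⁅⁆ {S = S} {x} x∈S w with w == x | ==-reflects w x
... | true  | ofʸ refl = trans (∨-zeroʳ _) (sym x∈S)
... | false | _        = trans (∨-identityʳ _) (∧-identityʳ (S w))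

∪⁅⁆─ : {S : VSet n} {v : GF2^ n} → S v ≡ false → S ∪ ⁅ v ⁆ ─ v ≗ S
∪⁅⁆─ {S = S} {v} v∉S w with w == v | ==-reflects w v
... | true  | ofʸ refl = trans (∧-zeroʳ _) (sym v∉S)
... | false | _        = trans (∧-identityʳ _) (∨-identityʳ (S w))

∪⁅⁆-absorb : {S : VSet n} {v : GF2^ n} → S v ≡ true → S ∪ ⁅ v ⁆ ≗ S
∪⁅⁆-absorb {S = S} {v} v∈S w with w == v | ==-reflects w v
... | true  | ofʸ refl = trans (∨-zeroʳ _) (sym v∈S)
... | false | _        = ∨-identityʳ (S w)

x∉S─x : (S : VSet n) (x : GF2^ n) → (S ─ x) x ≡ false
x∉S─x S x = trans (cong (λ b → S x ∧ not b) (==-refl x)) (∧-zeroʳ (S x))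

─-∌ : {S : VSet n} {x v : GF2^ n} → (S ─ x) v ≡ false → ¬ v ≡ x → S v ≡ false
─-∌ {S = S} {x} {v} v∉S─x v≢x with v == x | ==-reflects v x
... | true  | ofʸ v≡x = contradiction v≡x v≢x
... | false | _       = trans (sym (∧-identityʳ (S v))) v∉S─x

filterᵇ-map : {A B : Set} (p : A → Bool) (f : B → A) (xs : List B) →
  filterᵇ p (map f xs) ≡ map f (filterᵇ (p ∘ f) xs)
filterᵇ-map p f []       = refl
filterᵇ-map p f (x ∷ xs) with p (f x)
... | true  = cong (f x ∷_) (filterᵇ-map p f xs)
... | false = filterᵇ-map p f xs

filterᵇ-∅ : (vs : List (GF2^ n)) → filterᵇ ∅ vs ≡ []
filterᵇ-∅ vs = filter-none (T? ∘ ∅) (All.universal (λ _ ()) vs)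

filterᵇ-allVecs : (p : VSet (suc n)) → filterᵇ p (allVecs (suc n)) ≡
  map (false ∷_) (filterᵇ (p ∘ (false ∷_)) (allVecs n)) ++
  map (true ∷_) (filterᵇ (p ∘ (true ∷_)) (allVecs n))
filterᵇ-allVecs {n} p =
  trans (filter-++ (T? ∘ p) (map (false ∷_) (allVecs n)) _)
        (cong₂ _++_ (filterᵇ-map p (false ∷_) (allVecs n)) (filterᵇ-map p (true ∷_) (allVecs n)))

allVecs-⁅⁆ : (v : GF2^ n) → filterᵇ ⁅ v ⁆ (allVecs n) ≡ v ∷ []
allVecs-⁅⁆ []          = refl
allVecs-⁅⁆ (false ∷ v) = trans (filterᵇ-allVecs ⁅ false ∷ v ⁆)
  (cong₂ (λ xs ys → map (false ∷_) xs ++ map (true ∷_) ys) (allVecs-⁅⁆ v) (filterᵇ-∅ (allVecs _)))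
allVecs-⁅⁆ (true ∷ v)  = trans (filterᵇ-allVecs ⁅ true ∷ v ⁆)
  (cong₂ (λ xs ys → map (false ∷_) xs ++ map (true ∷_) ys) (filterᵇ-∅ (allVecs _)) (allVecs-⁅⁆ v))

length-filterᵇ-∨ : {A : Set} (p q : A → Bool) → (∀ x → p x ∧ q x ≡ false) → (xs : List A) →
  length (filterᵇ (λ x → p x ∨ q x) xs) ≡ length (filterᵇ p xs) + length (filterᵇ q xs)
length-filterᵇ-∨ p q disjoint [] = refl
length-filterᵇ-∨ p q disjoint (x ∷ xs)
  with p x | q x | disjoint x | length-filterᵇ-∨ p q disjoint xs
... | true  | false | _ | ih = cong suc ih
... | false | true  | _ | ih = trans (cong suc ih) (sym (+-suc _ _))
... | false | false | _ | ih = ih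

card-cong : {S S′ : VSet n} → S ≗ S′ → card S ≡ card S′
card-cong {n} {S} {S′} S≗S′ = cong length (filter-≐ (T? ∘ S) (T? ∘ S′) S≐S′ (allVecs n))
  where
  S≐S′ = (λ {v} → subst T (S≗S′ v)) , (λ {v} → subst T (sym (S≗S′ v)))

card-∪⁅⁆ : (S : VSet n) (v : GF2^ n) → S v ≡ false → card (S ∪ ⁅ v ⁆) ≡ card S + 1
card-∪⁅⁆ {n} S v v∉S = begin
  card (S ∪ ⁅ v ⁆)                            ≡⟨ length-filterᵇ-∨ S ⁅ v ⁆ disjoint (allVecs n) ⟩
  card S + length (filterᵇ ⁅ v ⁆ (allVecs n)) ≡⟨ cong (λ xs → card S + length xs) (allVecs-⁅⁆ v) ⟩
  card S + 1                                   ∎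
  where
  open ≡-Reasoning
  disjoint : ∀ w → S w ∧ (w == v) ≡ false
  disjoint w with w == v | ==-reflects w v
  ... | true  | ofʸ refl = trans (∧-identityʳ (S w)) v∉S
  ... | false | _        = ∧-zeroʳ (S w)

sumOver : List (GF2^ n) → VSet n → GF2^ n
sumOver vs a = foldr (λ v acc → if a v then v ⊕ acc else acc) 𝟎 vs

infixr 21 _·_
_·_ : Bool → GF2^ n → GF2^ n
b · v = if b then v else 𝟎

sumOver-∷ : (v : GF2^ n) (vs : List (GF2^ n)) (a : VSet n) →
  sumOver (v ∷ vs) a ≡ a v · v ⊕ sumOver vs a
sumOver-∷ v vs a with a v
... | true  = refl
... | false = sym (⊕-identityˡ _)

·-distribʳ-xor : (b c : Bool) (v : GF2^ n) → (b xor c) · v ≡ b · v ⊕ c · v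
·-distribʳ-xor true  true  v = sym (⊕-self v)
·-distribʳ-xor true  false v = sym (⊕-identityʳ v)
·-distribʳ-xor false c     v = sym (⊕-identityˡ (c · v))

sumOver-∆ : (vs : List (GF2^ n)) (a b : VSet n) → sumOver vs (a ∆ b) ≡ sumOver vs a ⊕ sumOver vs b
sumOver-∆ []       a b = sym (⊕-self 𝟎)
sumOver-∆ (v ∷ vs) a b = begin
  sumOver (v ∷ vs) (a ∆ b)
    ≡⟨ sumOver-∷ v vs (a ∆ b) ⟩
  (a v xor b v) · v ⊕ sumOver vs (a ∆ b)
    ≡⟨ cong₂ _⊕_ (·-distribʳ-xor (a v) (b v) v) (sumOver-∆ vs a b) ⟩
  (a v · v ⊕ b v · v) ⊕ (sumOver vs a ⊕ sumOver vs b)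
    ≡⟨ ⊕-interchange _ _ _ _ ⟩
  (a v · v ⊕ sumOver vs a) ⊕ (b v · v ⊕ sumOver vs b)
    ≡⟨ cong₂ _⊕_ (sumOver-∷ v vs a) (sumOver-∷ v vs b) ⟨
  sumOver (v ∷ vs) a ⊕ sumOver (v ∷ vs) b
    ∎
  where open ≡-Reasoning

sumOver-∅ : (vs : List (GF2^ n)) → sumOver vs ∅ ≡ 𝟎
sumOver-∅ []       = refl
sumOver-∅ (_ ∷ vs) = sumOver-∅ vs

sumOver-filterᵇ : (vs : List (GF2^ n)) (a : VSet n) → sumOver vs a ≡ foldr _⊕_ 𝟎 (filterᵇ a vs)
sumOver-filterᵇ []       a = refl
sumOver-filterᵇ (v ∷ vs) a with a v
... | true  = cong (v ⊕_) (sumOver-filterᵇ vs a)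
... | false = sumOver-filterᵇ vs a

sumSet-∆ : (a b : VSet n) → sumSet (a ∆ b) ≡ sumSet a ⊕ sumSet b
sumSet-∆ = sumOver-∆ (allVecs _)

sumSet-⁅⁆ : (v : GF2^ n) → sumSet ⁅ v ⁆ ≡ v
sumSet-⁅⁆ {n} v = begin
  sumSet ⁅ v ⁆                             ≡⟨ sumOver-filterᵇ (allVecs n) ⁅ v ⁆ ⟩
  foldr _⊕_ 𝟎 (filterᵇ ⁅ v ⁆ (allVecs n))  ≡⟨ cong (foldr _⊕_ 𝟎) (allVecs-⁅⁆ v) ⟩
  v ⊕ 𝟎                                    ≡⟨ ⊕-identityʳ v ⟩
  v                                        ∎
  where open ≡-Reasoning

-- Span and linear independence

Span : VSet n → GF2^ n → Set
Span S v = Σ[ a ∈ VSet _ ] a ⊆ S × sumSet a ≡ v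

span-𝟎 : {S : VSet n} → Span S 𝟎
span-𝟎 = ∅ , (λ _ ()) , sumOver-∅ (allVecs _)

span-⊕ : {S : VSet n} {u v : GF2^ n} → Span S u → Span S v → Span S (u ⊕ v)
span-⊕ (a , a⊆S , Σa≡u) (b , b⊆S , Σb≡v) =
  a ∆ b , ∆-⊆ a⊆S b⊆S , trans (sumSet-∆ a b) (cong₂ _⊕_ Σa≡u Σb≡v)

span-∈ : {S : VSet n} {v : GF2^ n} → S v ≡ true → Span S v
span-∈ v∈S = ⁅ _ ⁆ , ⁅⁆-⊆ v∈S , sumSet-⁅⁆ _

Span-mono : {S S′ : VSet n} {v : GF2^ n} → S ⊆ S′ → Span S v → Span S′ v
Span-mono S⊆S′ (a , a⊆S , Σa≡v) = a , ⊆-trans a⊆S S⊆S′ , Σa≡v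

¬span⇒∉ : {S : VSet n} {v : GF2^ n} → ¬ Span S v → S v ≡ false
¬span⇒∉ {S = S} {v} ¬span with S v in v∈S
... | true  = contradiction (span-∈ v∈S) ¬span
... | false = refl

¬¬span-⊕ : {S : VSet n} {u v : GF2^ n} → ¬ ¬ Span S u → ¬ ¬ Span S v → ¬ ¬ Span S (u ⊕ v)
¬¬span-⊕ ¬¬u ¬¬v ¬u⊕v = ¬¬u λ u → ¬¬v λ v → ¬u⊕v (span-⊕ u v)

LinIndep-⊆ : {S S′ : VSet n} → S ⊆ S′ → LinIndep S′ → LinIndep S
LinIndep-⊆ S⊆S′ indep a a⊆S = indep a (⊆-trans a⊆S S⊆S′)

span⇒¬LinIndep-∪⁅⁆ : {S : VSet n} {v : GF2^ n} → S v ≡ false → Span S v → ¬ LinIndep (S ∪ ⁅ v ⁆)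
span⇒¬LinIndep-∪⁅⁆ {S = S} {v} v∉S (a , a⊆S , Σa≡v) indep =
  contradiction (indep (a ∆ ⁅ v ⁆) a∆v⊆ Σa∆v≡𝟎 v) a∆v∋v
  where
  a∆v⊆ : a ∆ ⁅ v ⁆ ⊆ S ∪ ⁅ v ⁆
  a∆v⊆ = ∆-⊆ (⊆-trans a⊆S (⊆-∪ˡ S ⁅ v ⁆)) (⊆-∪ʳ S ⁅ v ⁆)
  Σa∆v≡𝟎 : sumSet (a ∆ ⁅ v ⁆) ≡ 𝟎
  Σa∆v≡𝟎 = trans (sumSet-∆ a ⁅ v ⁆) (trans (cong₂ _⊕_ Σa≡v (sumSet-⁅⁆ v)) (⊕-self v))
  a∆v∋v : ¬ (a v xor (v == v)) ≡ false
  a∆v∋v rewrite ∌-⊆ a⊆S v∉S | ==-refl v = λ ()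

LinIndep-∪⁅⁆ : {S : VSet n} {v : GF2^ n} → LinIndep S → ¬ Span S v → LinIndep (S ∪ ⁅ v ⁆)
LinIndep-∪⁅⁆ {S = S} {v} indep ¬span a a⊆ Σa≡𝟎 = indep a (⊆-∪⁅⁆ a⊆ a∌v) Σa≡𝟎
  where
  a∌v : a v ≡ false
  a∌v with a v in a∋v
  ... | false = refl
  ... | true  = contradiction (a ∆ ⁅ v ⁆ , ⊆-∪⁅⁆ (∆-⊆ a⊆ (⊆-∪ʳ S ⁅ v ⁆)) a∆v∌v , Σa∆v≡v) ¬span
    where
    a∆v∌v : a v xor (v == v) ≡ false
    a∆v∌v rewrite a∋v | ==-refl v = refl
    Σa∆v≡v : sumSet (a ∆ ⁅ v ⁆) ≡ v
    Σa∆v≡v = trans (sumSet-∆ a ⁅ v ⁆) (trans (cong₂ _⊕_ Σa≡𝟎 (sumSet-⁅⁆ v)) (⊕-identityˡ v))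

-- The exchange lemma

module Exchange {B : VSet n} {y : GF2^ n} (y∈B : B y ≡ true) (B-basis : IsBasis B) where

  card-B─y : card (B ─ y) + 1 ≡ n
  card-B─y = begin
    card (B ─ y) + 1       ≡⟨ card-∪⁅⁆ (B ─ y) y (x∉S─x B y) ⟨
    card (B ─ y ∪ ⁅ y ⁆)   ≡⟨ card-cong (─∪⁅⁆ {S = B} y∈B) ⟩
    card B                 ≡⟨ proj₁ B-basis ⟩
    n                      ∎
    where open ≡-Reasoning

  span⇒¬basis : {v : GF2^ n} → Span (B ─ y) v → ¬ IsBasis (swap B y v)
  span⇒¬basis {v} span with (B ─ y) v in v∈B─y
  ... | true  = λ (card≡n , _) → m+1+n≢m n (begin
    n + 1                  ≡⟨ cong (_+ 1) card≡n ⟨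
    card (swap B y v) + 1  ≡⟨ cong (_+ 1) (card-cong (∪⁅⁆-absorb {S = B ─ y} v∈B─y)) ⟩
    card (B ─ y) + 1       ≡⟨ card-B─y ⟩
    n                      ∎)
    where open ≡-Reasoning
  ... | false = span⇒¬LinIndep-∪⁅⁆ v∈B─y span ∘ proj₂

  ¬span⇒basis : {v : GF2^ n} → ¬ Span (B ─ y) v → IsBasis (swap B y v)
  ¬span⇒basis {v} ¬span = trans (card-∪⁅⁆ (B ─ y) v (¬span⇒∉ ¬span)) card-B─y
                        , LinIndep-∪⁅⁆ (LinIndep-⊆ (─-⊆ B y) (proj₂ B-basis)) ¬span

  ¬span⇒Exin : {v : GF2^ n} → ¬ Span (B ─ y) v → Exin B y v
  ¬span⇒Exin {v} ¬span with v == y | ==-reflects v y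
  ... | true  | ofʸ v≡y = inj₂ v≡y
  ... | false | ofⁿ v≢y = inj₁ (─-∌ {S = B} (¬span⇒∉ ¬span) v≢y , ¬span⇒basis ¬span)

  Exin⇒¬span : {v : GF2^ n} → Exin B y v → ¬ Span (B ─ y) v
  Exin⇒¬span (inj₁ (_ , basis)) span = span⇒¬basis span basis
  Exin⇒¬span (inj₂ refl)        span =
    span⇒¬LinIndep-∪⁅⁆ (x∉S─x B y) span (LinIndep-⊆ (≗⇒⊆ (─∪⁅⁆ y∈B)) (proj₂ B-basis))

-- Binary representation and increment

bin<2^ : (v : GF2^ n) → bin v < 2 ^ n
bin<2^ []                  = s≤s z≤n
bin<2^ {suc n} (false ∷ v) = <-≤-trans (bin<2^ v) (m≤m+n (2 ^ n) _)
bin<2^ {suc n} (true ∷ v)  = begin-strict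
  1 * 2 ^ n + bin v  <⟨ +-monoʳ-< (1 * 2 ^ n) (bin<2^ v) ⟩
  1 * 2 ^ n + 2 ^ n  ≡⟨ +-comm (1 * 2 ^ n) (2 ^ n) ⟩
  2 ^ suc n          ∎
  where open ≤-Reasoning

2^≤bin-true∷ : (v : GF2^ n) → 2 ^ n ≤ bin (true ∷ v)
2^≤bin-true∷ {n} v = ≤-trans (≤-reflexive (sym (*-identityˡ (2 ^ n)))) (m≤m+n (1 * 2 ^ n) (bin v))

c*-≺ : {i j : Fin n} → toℕ i < toℕ j → c* j ≺ c* i
c*-≺ {suc n} {zero}  {suc j} _         = <-≤-trans (bin<2^ (c* j)) (2^≤bin-true∷ (𝟎 {n}))
c*-≺ {suc n} {suc i} {suc j} (s≤s i<j) = c*-≺ {i = i} i<j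

inc : GF2^ n → GF2^ n
inc v = proj₂ (inc' v)

carry⇒inc≡𝟎 : (v : GF2^ n) → proj₁ (inc' v) ≡ true → inc v ≡ 𝟎
carry⇒inc≡𝟎 []          _     = refl
carry⇒inc≡𝟎 (true ∷ v)  carry = cong₂ _∷_ (cong not carry) (carry⇒inc≡𝟎 v carry)

inc-preserves-before-ones : (v : GF2^ n) {j p : Fin n} →
  lookup (inc v) j ≡ true → toℕ p < toℕ j → lookup v p ≡ lookup (inc v) p
inc-preserves-before-ones (b ∷ v) {suc j} {zero} one _ with proj₁ (inc' v) in carry
... | false = sym (xor-identityʳ b)
... | true  = contradiction (trans (sym one) (trans (cong (λ u → lookup u j) (carry⇒inc≡𝟎 v carry))
                                                   (lookup-replicate j false))) λ ()
inc-preserves-before-ones (b ∷ v) {suc j} {suc p} one (s≤s p<j) =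
  inc-preserves-before-ones v one p<j

Succ-preserves-before-ones : (v : GF2^ n) {j p : Fin n} →
  lookup (Succ v) j ≡ true → toℕ p < toℕ j → lookup v p ≡ lookup (Succ v) p
Succ-preserves-before-ones v {j} {p} = by-cases ((v == 𝟎) ∨ (v == 𝟏))
  where
  by-cases : (wraps : Bool) → lookup (if wraps then 𝟎 else inc v) j ≡ true → toℕ p < toℕ j →
    lookup v p ≡ lookup (if wraps then 𝟎 else inc v) p
  by-cases true  one = contradiction (trans (sym one) (lookup-replicate j false)) λ ()
  by-cases false one = inc-preserves-before-ones v one

-- Vectors vanishing on the first coordinates

units-generate : (P : GF2^ n → Set) → P 𝟎 → (∀ {u v} → P u → P v → P (u ⊕ v)) →
  (w : GF2^ n) → (∀ j → lookup w j ≡ true → P (c* j)) → P w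
units-generate P p𝟎 p⊕ []          _     = p𝟎
units-generate P p𝟎 p⊕ (false ∷ w) units = units-generate (P ∘ (false ∷_)) p𝟎 p⊕ w (units ∘ suc)
units-generate P p𝟎 p⊕ (true ∷ w)  units = subst (P ∘ (true ∷_)) (⊕-identityˡ w)
  (p⊕ (units zero refl) (units-generate (P ∘ (false ∷_)) p𝟎 p⊕ w (units ∘ suc)))

module SpannedAbove {Q : VSet n} (i : Fin n)
                    (units-above-i : ∀ j → toℕ i < toℕ j → ¬ ¬ Span Q (c* j)) where

  vanishing-upto-i⇒spanned : (w : GF2^ n) → (∀ p → toℕ p ≤ toℕ i → lookup w p ≡ false) →
    ¬ ¬ Span Q w
  vanishing-upto-i⇒spanned w vanishing =
    units-generate (λ u → ¬ ¬ Span Q u) (λ ¬span → ¬span span-𝟎) ¬¬span-⊕ w λ j wj →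
      units-above-i j (≰⇒> λ j≤i → contradiction (trans (sym wj) (vanishing j j≤i)) λ ())

  agreeing-upto-i⇒spanned : {z : GF2^ n} → ¬ ¬ Span Q z →
    (z′ : GF2^ n) → (∀ p → toℕ p ≤ toℕ i → lookup z′ p ≡ lookup z p) → ¬ ¬ Span Q z′
  agreeing-upto-i⇒spanned {z} z-spanned z′ agree =
    subst (λ u → ¬ ¬ Span Q u) (x⊕y⊕y≡x z′ z)
          (¬¬span-⊕ (vanishing-upto-i⇒spanned (z′ ⊕ z) vanishing) z-spanned)
    where
    vanishing : ∀ p → toℕ p ≤ toℕ i → lookup (z′ ⊕ z) p ≡ false
    vanishing p p≤i = begin
      lookup (z′ ⊕ z) p               ≡⟨ lookup-zipWith _xor_ p z′ z ⟩
      lookup z′ p xor lookup z p      ≡⟨ cong (_xor lookup z p) (agree p p≤i) ⟩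
      lookup z p xor lookup z p       ≡⟨ xor-same (lookup z p) ⟩
      false                           ∎
      where open ≡-Reasoning

  -- A one of Succ υ above i would make υ agree with Succ υ up to i, and so be spanned.
  Succ-vanishes-above-i : {υ : GF2^ n} → ¬ Span Q υ → ¬ ¬ Span Q (Succ υ) →
    ∀ j → toℕ i < toℕ j → lookup (Succ υ) j ≡ false
  Succ-vanishes-above-i {υ} υ∉span z-spanned j i<j with lookup (Succ υ) j in one
  ... | false = refl
  ... | true  = ⊥-elim (agreeing-upto-i⇒spanned z-spanned υ
                   (λ p p≤i → Succ-preserves-before-ones υ one (≤-<-trans p≤i i<j)) υ∉span)

lemma16 : (r : ℕ) → 1 ≤ r → (B : VSet r) → IsBasis B → ¬ EqR B →
    (y : GF2^ r) → IsMin (λ v → B v ≡ true × ¬ InR v) y →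
    (i : Fin r) → IsMin (λ v → InR v × Exin B y v) (c* i) →
    (υ : GF2^ r) → Exin (swap B y (c* i)) (c* i) υ →
    ¬ IsBasis (swap (swap B y (c* i)) (c* i) (Succ υ)) →
    ((j : Fin r) → toℕ i < toℕ j → lookup (Succ υ) j ≡ false)
    × ((z' : GF2^ r) → ((p : Fin r) → toℕ p ≤ toℕ i → lookup z' p ≡ lookup (Succ υ) p) →
       ¬ IsBasis (swap (swap B y (c* i)) (c* i) z'))
lemma16 r _ B B-basis _ y ((y∈B , y∉R) , _) i ((_ , c-exchangeable) , c-minimal) υ υ-exchangeable
        z-dependent = Succ-vanishes-above-i υ∉span z∈span , agreeing-nonbasis
  where
  open Exchange y∈B B-basis

  c∉B×P-basis : B (c* i) ≡ false × IsBasis (swap B y (c* i))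
  c∉B×P-basis = [ id , (λ c≡y → contradiction (i , sym c≡y) y∉R) ]′ c-exchangeable

  module P = Exchange (⊆-∪ʳ (B ─ y) ⁅ c* i ⁆ (c* i) (==-refl (c* i))) (proj₂ c∉B×P-basis)

  P─c≗B─y : swap B y (c* i) ─ c* i ≗ B ─ y
  P─c≗B─y = ∪⁅⁆─ {S = B ─ y} (cong (_∧ not (c* i == y)) (proj₁ c∉B×P-basis))

  units-above-i-spanned : ∀ j → toℕ i < toℕ j → ¬ ¬ Span (B ─ y) (c* j)
  units-above-i-spanned j i<j ¬span =
    c-minimal (c* j) ((j , refl) , ¬span⇒Exin ¬span) (c*-≺ {i = i} i<j)

  open SpannedAbove i units-above-i-spanned

  υ∉span : ¬ Span (B ─ y) υ
  υ∉span = P.Exin⇒¬span υ-exchangeable ∘ Span-mono (≗⇒⊆ (sym ∘ P─c≗B─y))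

  z∈span : ¬ ¬ Span (B ─ y) (Succ υ)
  z∈span = z-dependent ∘ P.¬span⇒basis ∘ (_∘ Span-mono (≗⇒⊆ P─c≗B─y))

  agreeing-nonbasis : ∀ z′ → (∀ p → toℕ p ≤ toℕ i → lookup z′ p ≡ lookup (Succ υ) p) →
    ¬ IsBasis (swap (swap B y (c* i)) (c* i) z′)
  agreeing-nonbasis z′ agree basis =
    agreeing-upto-i⇒spanned z∈span z′ agree λ span →
      P.span⇒¬basis (Span-mono (≗⇒⊆ (sym ∘ P─c≗B─y)) span) basis
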